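{- Let $n\ge 11$ and $T_{n,n-4}=\frac{n(n+1)}{2}-(n-4)$. Then $\#\mathbb U^*_{T_{n,n-4}}=1$.
   Context: A partition of $N$ into distinct parts is a sequence of positive integers $\lambda_1<\dots<\lambda_t$ summing to $N$ with $t\ge 2$. Its missing parts are the elements of $\{1,\dots,\lambda_t\}\setminus\{\lambda_1,\dots,\lambda_t\}$. $\lambda$ is refinable if two distinct missing parts sum to a part of $\lambda$, unrefinable otherwise; $\mathbb U_N$ is the set of unrefinable partitions of $N$. $\mathbb U^*_N$ is the set of $\lambda\in\mathbb U_N$ whose largest part is the maximum of the largest parts over all of $\mathbb U_N$. Standing assumption: $n\ge 11$. -}

module Defs where

open import Data.Nat using (ℕ; _+_; _*_; _∸_; _≤_; _<_; _⊔_; suc)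
open import Data.Nat.DivMod using (_/_)
open import Data.List using (List; length; foldr)
open import Data.Nat.ListAction using (sum)
open import Data.List.Relation.Unary.All using (All)
open import Data.List.Relation.Unary.Linked using (Linked)
open import Data.List.Membership.Propositional using (_∈_; _∉_)
open import Data.Product using (_×_; ∃-syntax)
open import Relation.Nullary using (¬_)
open import Relation.Binary.PropositionalEquality using (_≡_; _≢_)

record IsDistinctPartition (N : ℕ) (λs : List ℕ) : Set where
  field
    increasing : Linked _<_ λs
    positive   : All (1 ≤_) λs
    sums       : sum λs ≡ N
    atLeastTwo : 2 ≤ length λs

largest : List ℕ → ℕ
largest = foldr _⊔_ 0

Missing : List ℕ → ℕ → Set
Missing λs m = (1 ≤ m) × (m ≤ largest λs) × (m ∉ λs)

Refinable : List ℕ → Set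
Refinable λs = ∃[ a ] ∃[ b ] (a ≢ b × Missing λs a × Missing λs b × (a + b) ∈ λs)

Unrefinable : ℕ → List ℕ → Set
Unrefinable N λs = IsDistinctPartition N λs × ¬ Refinable λs

InUStar : ℕ → List ℕ → Set
InUStar N λs = Unrefinable N λs × (∀ μ → Unrefinable N μ → largest μ ≤ largest λs)

T : ℕ → ℕ → ℕ
T n k = (n * suc n) / 2 ∸ k

{-# OPTIONS --safe #-}
module Submission where

-- Let μ be an unrefinable partition of N with largest part L. For 0 < a < L/2 the numbers a
-- and L − a cannot both be missing, since they would refine the part L; so each pair
-- {a, L − a} contributes at least a to N, the pair {0, L} contributes L, and
-- N ≥ L + (1 + ⋯ + (⌈L/2⌉ − 1)) with the excess distributed over the pairs.
-- With n = 11 + m we have N = T_{n,n−4} = (1 + ⋯ + (n − 3)) + 2n + 1, and the bound rules out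
-- L ≥ 2n − 3. For L = 2n − 4 the excess would be 5: the middle number n − 2 exceeds it, so is
-- not a part, and every pair has even excess L − 2a (a pair lying entirely in μ would have
-- excess L − a > 5), a contradiction. For L = 2n − 5 the excess is 6: pairs with a ≤ n − 6 have no room for any excess,
-- and the pairs (n − 5, n), (n − 4, n − 1), (n − 3, n − 2) can only have excess 5, 3, 1
-- respectively or 0, so 6 = 5 + 1 forces μ = {1, …, n − 6, n − 4, n − 2, n, 2n − 5}.

open import Defs
open import Data.Empty using (⊥)
open import Data.List using (List; []; _∷_; [_]; _∷ʳ_; _++_; applyUpTo; last; length)
open import Data.List.Properties using (applyUpTo-∷ʳ)
open import Data.List.Membership.Propositional using (_∈_; _∉_)
open import Data.List.Membership.Propositional.Properties
  using (∈-++⁺ˡ; ∈-++⁺ʳ; ∈-++⁻; ∈-applyUpTo⁺; ∈-applyUpTo⁻)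
open import Data.List.Membership.Propositional.Properties.WithK using (unique∧set⇒bag)
open import Data.List.Relation.Binary.BagAndSetEquality using (∼bag⇒↭)
open import Data.List.Relation.Binary.Equality.Propositional using (≋⇒≡)
open import Data.List.Relation.Binary.Permutation.Propositional using (↭⇒↭ₛ′)
open import Data.List.Relation.Unary.All as All using (All; []; _∷_)
import Data.List.Relation.Unary.All.Properties as All
open import Data.List.Relation.Unary.AllPairs as AllPairs using (_∷_)
open import Data.List.Relation.Unary.Any using (here; there)
open import Data.List.Relation.Unary.Linked as Linked using (Linked; [-]; _∷_)
import Data.List.Relation.Unary.Linked.Properties as Linked
open import Data.List.Relation.Unary.Sorted.TotalOrder.Properties using (↗↭↗⇒≋)
open import Data.List.Relation.Unary.Unique.Propositional using (Unique)
open import Data.Maybe using (just)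
open import Data.Maybe.Relation.Binary.Connected using (Connected; just)
open import Data.Nat
open import Data.Nat.DivMod using (m*n/n≡m)
open import Data.Nat.Divisibility using (_∣_; _∣?_; _∣0; divides; ∣m∣n⇒∣m+n; ∣m+n∣m⇒∣n)
open import Data.Nat.ListAction using (sum)
open import Data.Nat.ListAction.Properties using (sum-++)
open import Data.Nat.Properties
open import Algebra.Properties.CommutativeSemigroup +-commutativeSemigroup
  using (interchange; xy∙z≈xz∙y)
open import Data.Nat.Tactic.RingSolver using (solve-∀)
open import Data.List.Membership.DecPropositional _≟_ using (_∈?_)
open import Data.Product using (∃; ∃₂; ∃-syntax; _×_; _,_; proj₁; proj₂; map₂)
open import Data.Sum using (_⊎_; inj₁; inj₂; [_,_]′)
open import Function using (_∘_; id; _⇔_; mk⇔)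
open import Relation.Binary.Definitions using (tri<; tri≈; tri>)
open import Relation.Binary.PropositionalEquality hiding ([_])
open import Relation.Nullary using (¬_; yes; no; contradiction)
open import Relation.Nullary.Decidable using (from-no)

∑ : ℕ → (ℕ → ℕ) → ℕ
∑ k f = sum (applyUpTo f k)

∑-snoc : ∀ k f → ∑ (suc k) f ≡ ∑ k f + f k
∑-snoc k f = begin
  sum (applyUpTo f (suc k))   ≡⟨ cong sum (applyUpTo-∷ʳ f k) ⟨
  sum (applyUpTo f k ∷ʳ f k)  ≡⟨ sum-++ (applyUpTo f k) [ f k ] ⟩
  ∑ k f + (f k + 0)           ≡⟨ cong (∑ k f +_) (+-identityʳ (f k)) ⟩
  ∑ k f + f k                 ∎
  where open ≡-Reasoning

∑-snoc³ : ∀ k f → ∑ (3 + k) f ≡ ∑ k f + f k + f (1 + k) + f (2 + k)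
∑-snoc³ k f = trans (∑-snoc (2 + k) f) (cong (_+ f (2 + k))
                (trans (∑-snoc (1 + k) f) (cong (_+ f (1 + k)) (∑-snoc k f))))

∑-cong : ∀ k {f g} → (∀ {a} → a < k → f a ≡ g a) → ∑ k f ≡ ∑ k g
∑-cong zero    f≡g = refl
∑-cong (suc k) f≡g = cong₂ _+_ (f≡g z<s) (∑-cong k (f≡g ∘ s<s))

∑-mono-≤ : ∀ k {f g} → (∀ {a} → a < k → f a ≤ g a) → ∑ k f ≤ ∑ k g
∑-mono-≤ zero    f≤g = z≤n
∑-mono-≤ (suc k) f≤g = +-mono-≤ (f≤g z<s) (∑-mono-≤ k (f≤g ∘ s<s))

∑-zero : ∀ k {f} → (∀ {a} → a < k → f a ≡ 0) → ∑ k f ≡ 0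
∑-zero zero    f≡0 = refl
∑-zero (suc k) f≡0 = cong₂ _+_ (f≡0 z<s) (∑-zero k (f≡0 ∘ s<s))

∑-single : ∀ k {f a} → a < k → (∀ {b} → b < k → b ≢ a → f b ≡ 0) → ∑ k f ≡ f a
∑-single (suc k) {f} {zero} z<s others =
  trans (cong (f 0 +_) (∑-zero k (λ b<k → others (s<s b<k) λ ()))) (+-identityʳ (f 0))
∑-single (suc k) {f} {suc a} (s<s a<k) others =
  cong₂ _+_ (others z<s λ ()) (∑-single k a<k (λ b<k b≢a → others (s<s b<k) (b≢a ∘ suc-injective)))

∑-+ : ∀ k f g → ∑ k (λ a → f a + g a) ≡ ∑ k f + ∑ k g
∑-+ zero    f g = refl
∑-+ (suc k) f g = trans (cong (f 0 + g 0 +_) (∑-+ k (f ∘ suc) (g ∘ suc)))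
                        (interchange (f 0) (g 0) (∑ k (f ∘ suc)) (∑ k (g ∘ suc)))

∑-++ : ∀ j k f → ∑ (j + k) f ≡ ∑ j f + ∑ k (f ∘ (j +_))
∑-++ zero    k f = refl
∑-++ (suc j) k f = trans (cong (f 0 +_) (∑-++ j k (f ∘ suc))) (sym (+-assoc (f 0) _ _))

∑-≤-length : ∀ {j k} f → j ≤ k → ∑ j f ≤ ∑ k f
∑-≤-length {j} f j≤k with d , refl ← m≤n⇒∃[o]m+o≡n j≤k =
  ≤-trans (m≤m+n (∑ j f) _) (≤-reflexive (sym (∑-++ j d f)))

∑-reverse : ∀ k f → ∑ k f ≡ ∑ k (λ a → f (k ∸ suc a))
∑-reverse zero    f = refl
∑-reverse (suc k) f = begin
  ∑ (suc k) f                      ≡⟨ ∑-snoc k f ⟩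
  ∑ k f + f k                      ≡⟨ cong (_+ f k) (∑-reverse k f) ⟩
  ∑ k (λ a → f (k ∸ suc a)) + f k  ≡⟨ +-comm _ (f k) ⟩
  f k + ∑ k (λ a → f (k ∸ suc a))  ∎
  where open ≡-Reasoning

∑-fold : ∀ k j h →
         ∑ (k + j + k) h ≡ ∑ k (λ a → h a + h (k + j + k ∸ suc a)) + ∑ j (h ∘ (k +_))
∑-fold k j h = begin
  ∑ (k + j + k) h
    ≡⟨ ∑-++ (k + j) k h ⟩
  ∑ (k + j) h + ∑ k (h ∘ (k + j +_))
    ≡⟨ cong₂ _+_ (∑-++ k j h) (∑-reverse k (h ∘ (k + j +_))) ⟩
  ∑ k h + ∑ j (h ∘ (k +_)) + ∑ k (λ a → h (k + j + (k ∸ suc a)))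
    ≡⟨ cong (∑ k h + ∑ j (h ∘ (k +_)) +_) (∑-cong k λ a<k → cong h (sym (+-∸-assoc (k + j) a<k))) ⟩
  ∑ k h + ∑ j (h ∘ (k +_)) + ∑ k (λ a → h (k + j + k ∸ suc a))
    ≡⟨ xy∙z≈xz∙y (∑ k h) _ _ ⟩
  ∑ k h + ∑ k (λ a → h (k + j + k ∸ suc a)) + ∑ j (h ∘ (k +_))
    ≡⟨ cong (_+ ∑ j (h ∘ (k +_))) (∑-+ k h _) ⟨
  ∑ k (λ a → h a + h (k + j + k ∸ suc a)) + ∑ j (h ∘ (k +_))
    ∎
  where open ≡-Reasoning

term≤∑ : ∀ k f {a} → a < k → f a ≤ ∑ k f
term≤∑ (suc k) f {zero}  z<s        = m≤m+n (f 0) _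
term≤∑ (suc k) f {suc a} (s<s a<k) = ≤-trans (term≤∑ k (f ∘ suc) a<k) (m≤n+m _ (f 0))

∑-slack : ∀ k {f g c} → (∀ {b} → b < k → f b ≤ g b) → ∑ k g ≡ ∑ k f + c →
          ∀ {a} → a < k → g a ≤ f a + c
∑-slack k {f} {g} {c} f≤g ∑g≡ {a} a<k = begin
  g a          ≡⟨ m+[n∸m]≡n (f≤g a<k) ⟨
  f a + d a    ≤⟨ +-monoʳ-≤ (f a) (term≤∑ k d a<k) ⟩
  f a + ∑ k d  ≡⟨ cong (f a +_) ∑d≡c ⟩
  f a + c      ∎
  where
  open ≤-Reasoning
  d : ℕ → ℕ
  d b = g b ∸ f b
  ∑d≡c : ∑ k d ≡ c
  ∑d≡c = +-cancelˡ-≡ (∑ k f) _ _ (begin-equality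
    ∑ k f + ∑ k d              ≡⟨ ∑-+ k f d ⟨
    ∑ k (λ b → f b + d b)      ≡⟨ ∑-cong k (λ b<k → m+[n∸m]≡n (f≤g b<k)) ⟩
    ∑ k g                      ≡⟨ ∑g≡ ⟩
    ∑ k f + c                  ∎)

∣-∑ : ∀ k {d f} → (∀ {a} → a < k → d ∣ f a) → d ∣ ∑ k f
∣-∑ zero    {d} _   = d ∣0
∣-∑ (suc k)     d∣f = ∣m∣n⇒∣m+n (d∣f z<s) (∣-∑ k (d∣f ∘ s<s))

2∣n+n : ∀ n → 2 ∣ n + n
2∣n+n n = divides n (sym (trans (*-comm n 2) (cong (n +_) (+-identityʳ n))))

triangular : ℕ → ℕ
triangular k = ∑ k id

triangular-double : ∀ n → triangular (suc n) * 2 ≡ n * suc n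
triangular-double zero    = refl
triangular-double (suc n) = begin
  triangular (suc (suc n)) * 2        ≡⟨ cong (_* 2) (∑-snoc (suc n) id) ⟩
  (triangular (suc n) + suc n) * 2    ≡⟨ *-distribʳ-+ 2 (triangular (suc n)) (suc n) ⟩
  triangular (suc n) * 2 + suc n * 2  ≡⟨ cong (_+ suc n * 2) (triangular-double n) ⟩
  n * suc n + suc n * 2               ≡⟨ step n ⟩
  suc n * suc (suc n)                 ∎
  where
  open ≡-Reasoning
  step : ∀ n → n * suc n + suc n * 2 ≡ suc n * suc (suc n)
  step = solve-∀

halve : ∀ n → ∃₂ λ k j → j ≤ 1 × n ≡ k + j + k
halve zero = 0 , 0 , z≤n , refl
halve (suc n) with halve n
... | k , 0 , _ , n≡ = k , 1 , ≤-refl , trans (cong suc n≡) (even-step k)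
  where
  even-step : ∀ k → suc (k + 0 + k) ≡ k + 1 + k
  even-step = solve-∀
... | k , 1 , _ , n≡ = suc k , 0 , z≤n , trans (cong suc n≡) (odd-step k)
  where
  odd-step : ∀ k → suc (k + 1 + k) ≡ suc k + 0 + suc k
  odd-step = solve-∀
... | k , 2+ _ , s≤s () , _

≤-offset : ∀ {c x} → c ≤ x → ∃ λ d → x ≡ d + c
≤-offset {c} c≤x = map₂ (λ c+d≡x → trans (sym c+d≡x) (+-comm c _)) (m≤n⇒∃[o]m+o≡n c≤x)

last-applyUpTo : ∀ {A : Set} (f : ℕ → A) n → last (applyUpTo f (suc n)) ≡ just (f n)
last-applyUpTo f zero    = refl
last-applyUpTo f (suc n) = last-applyUpTo (f ∘ suc) n

pointMass : ℕ → ℕ → ℕ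
pointMass y x with x ≟ y
... | yes _ = x
... | no  _ = 0

pointMass-≢ : ∀ {x y} → x ≢ y → pointMass y x ≡ 0
pointMass-≢ {x} {y} x≢y with x ≟ y
... | yes x≡y = contradiction x≡y x≢y
... | no  _   = refl

pointMass-refl : ∀ y → pointMass y y ≡ y
pointMass-refl y with y ≟ y
... | yes _   = refl
... | no  y≢y = contradiction refl y≢y

∑-pointMass : ∀ {M y} → y < M → ∑ M (pointMass y) ≡ y
∑-pointMass {M} {y} y<M = trans (∑-single M y<M (λ _ → pointMass-≢)) (pointMass-refl y)

weight : List ℕ → ℕ → ℕ
weight []       x = 0
weight (y ∷ ys) x = pointMass y x + weight ys x

∑-weight : ∀ M xs → All (_< M) xs → ∑ M (weight xs) ≡ sum xs
∑-weight M []       _             = ∑-zero M (λ _ → refl)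
∑-weight M (y ∷ ys) (y<M ∷ ys<M) =
  trans (∑-+ M (pointMass y) (weight ys)) (cong₂ _+_ (∑-pointMass y<M) (∑-weight M ys ys<M))

weight-∉ : ∀ {x} xs → x ∉ xs → weight xs x ≡ 0
weight-∉ []       _   = refl
weight-∉ (y ∷ ys) x∉ = cong₂ _+_ (pointMass-≢ (x∉ ∘ here)) (weight-∉ ys (x∉ ∘ there))

weight-∈ : ∀ {x xs} → Unique xs → x ∈ xs → weight xs x ≡ x
weight-∈ {x} {y ∷ ys} (y∉ys ∷ _) (here refl) =
  trans (cong₂ _+_ (pointMass-refl x) (weight-∉ ys λ x∈ys → All.lookup y∉ys x∈ys refl)) (+-identityʳ x)
weight-∈ {x} {y ∷ ys} (y∉ys ∷ ys!) (there x∈ys) =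
  trans (cong (_+ weight ys x) (pointMass-≢ {x} {y} λ { refl → All.lookup y∉ys x∈ys refl }))
        (weight-∈ ys! x∈ys)

∈⇒≤largest : ∀ {x} xs → x ∈ xs → x ≤ largest xs
∈⇒≤largest (y ∷ ys) (here refl) = m≤m⊔n y _
∈⇒≤largest (y ∷ ys) (there x∈) = ≤-trans (∈⇒≤largest ys x∈) (m≤n⊔m y _)

largest≤ : ∀ {c} xs → All (_≤ c) xs → largest xs ≤ c
largest≤ []       []           = z≤n
largest≤ (y ∷ ys) (y≤c ∷ ys≤c) = ⊔-lub y≤c (largest≤ ys ys≤c)

largest∈ : ∀ xs → 1 ≤ length xs → largest xs ∈ xs
largest∈ (x ∷ [])     _ = here (⊔-identityʳ x)
largest∈ (x ∷ ys@(_ ∷ _)) _ =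
  [ here , (λ ≡l → there (subst (_∈ ys) (sym ≡l) (largest∈ ys z<s))) ]′ (⊔-sel x (largest ys))

increasing⇒unique : ∀ {xs} → Linked _<_ xs → Unique xs
increasing⇒unique xs< = AllPairs.map <⇒≢ (Linked.Linked⇒AllPairs <-trans xs<)

increasing-≡ : ∀ {xs ys} → Linked _<_ xs → Linked _<_ ys → (∀ {x} → x ∈ xs ⇔ x ∈ ys) → xs ≡ ys
increasing-≡ xs< ys< xs⇔ys = ≋⇒≡ (↗↭↗⇒≋ ≤-totalOrder (Linked.map <⇒≤ xs<) (Linked.map <⇒≤ ys<)
  (↭⇒↭ₛ′ isEquivalence (∼bag⇒↭
    (unique∧set⇒bag (increasing⇒unique xs<) (increasing⇒unique ys<) xs⇔ys))))

module Pairs {N : ℕ} {μ : List ℕ} (μ-unrefinable : Unrefinable N μ) where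

  open IsDistinctPartition (proj₁ μ-unrefinable) public

  L : ℕ
  L = largest μ

  L∈μ : L ∈ μ
  L∈μ = largest∈ μ (≤-trans (s≤s z≤n) atLeastTwo)

  ≤L : ∀ {x} → x ∈ μ → x ≤ L
  ≤L = ∈⇒≤largest μ

  G : ℕ → ℕ
  G = weight μ

  G-∈ : ∀ {x} → x ∈ μ → G x ≡ x
  G-∈ = weight-∈ (increasing⇒unique increasing)

  G-∉ : ∀ {x} → x ∉ μ → G x ≡ 0
  G-∉ = weight-∉ μ

  ∑G≡N : ∑ (suc L) G ≡ N
  ∑G≡N = trans (∑-weight (suc L) μ (All.tabulate (s≤s ∘ ≤L))) sums

  G<⇒≡0 : ∀ {x} → G x < x → G x ≡ 0
  G<⇒≡0 {x} Gx<x with x ∈? μ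
  ... | yes x∈ = contradiction (G-∈ x∈) (<⇒≢ Gx<x)
  ... | no  x∉ = G-∉ x∉

  P : ℕ → ℕ
  P a = G a + G (L ∸ a)

  -- l a is the least value P a can take.
  l : ℕ → ℕ
  l zero    = L
  l (suc a) = suc a

  data Pair (a : ℕ) : Set where
    lower : a ∈ μ → L ∸ a ∉ μ → Pair a
    upper : a ∉ μ → L ∸ a ∈ μ → Pair a
    both  : a ∈ μ → L ∸ a ∈ μ → Pair a

  half<L : ∀ {a} → 1 ≤ a → a + a < L → a < L
  half<L {a} 1≤a 2a<L = <-trans (m<m+n a 1≤a) 2a<L

  pair : ∀ {a} → 1 ≤ a → a + a < L → Pair a
  pair {a} 1≤a 2a<L with a ∈? μ | L ∸ a ∈? μ
  ... | yes a∈ | no  b∉ = lower a∈ b∉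
  ... | no  a∉ | yes b∈ = upper a∉ b∈
  ... | yes a∈ | yes b∈ = both a∈ b∈
  ... | no  a∉ | no  b∉ = contradiction refinement (proj₂ μ-unrefinable)
    where
    a<L = half<L 1≤a 2a<L
    refinement : Refinable μ
    refinement = a , L ∸ a
               , (λ a≡ → <-irrefl (trans (cong (a +_) a≡) (m+[n∸m]≡n (<⇒≤ a<L))) 2a<L)
               , (1≤a , <⇒≤ a<L , a∉) , (m<n⇒0<n∸m a<L , m∸n≤m L a , b∉)
               , subst (_∈ μ) (sym (m+[n∸m]≡n (<⇒≤ a<L))) L∈μ

  P-lower : ∀ {a} → a ∈ μ → L ∸ a ∉ μ → P a ≡ a
  P-lower a∈ b∉ = trans (cong₂ _+_ (G-∈ a∈) (G-∉ b∉)) (+-identityʳ _)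

  P-upper : ∀ {a} → a ∉ μ → L ∸ a ∈ μ → P a ≡ L ∸ a
  P-upper a∉ b∈ = cong₂ _+_ (G-∉ a∉) (G-∈ b∈)

  P-both : ∀ {a} → a ≤ L → a ∈ μ → L ∸ a ∈ μ → P a ≡ L
  P-both a≤L a∈ b∈ = trans (cong₂ _+_ (G-∈ a∈) (G-∈ b∈)) (m+[n∸m]≡n a≤L)

  P0≡L : P 0 ≡ L
  P0≡L = cong₂ _+_ (G-∉ λ 0∈ → <-irrefl refl (All.lookup positive 0∈)) (G-∈ L∈μ)

  pairable : ∀ {K a} → K + K ≤ suc L → a < K → a + a < L
  pairable {K} {a} 2K≤ a<K =
    ≤-pred (≤-trans (≤-reflexive (cong suc (sym (+-suc a a)))) (≤-trans (+-mono-≤ a<K a<K) 2K≤))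

  l≤P : ∀ {K} → K + K ≤ suc L → ∀ {a} → a < K → l a ≤ P a
  l≤P _   {zero}  _   = ≤-reflexive (sym P0≡L)
  l≤P 2K≤ {suc a} a<K with pair z<s (pairable 2K≤ a<K)
  ... | lower a∈ b∉ = ≤-reflexive (sym (P-lower a∈ b∉))
  ... | upper a∉ b∈ =
    subst (suc a ≤_) (sym (P-upper a∉ b∈)) (m+n≤o⇒m≤o∸n (suc a) (<⇒≤ (pairable 2K≤ a<K)))
  ... | both  a∈ b∈ = subst (suc a ≤_) (sym (P-both (≤L a∈) a∈ b∈)) (≤L a∈)

  fold-P : ∀ K j → suc L ≡ K + j + K → ∑ K P + ∑ j (G ∘ (K +_)) ≡ N
  fold-P K j sL≡ = begin
    ∑ K P + ∑ j (G ∘ (K +_))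
      ≡⟨ cong (_+ ∑ j (G ∘ (K +_))) (∑-cong K λ {a} _ → cong (λ n → G a + G (n ∸ suc a)) sL≡) ⟩
    ∑ K (λ a → G a + G (K + j + K ∸ suc a)) + ∑ j (G ∘ (K +_))
      ≡⟨ ∑-fold K j G ⟨
    ∑ (K + j + K) G
      ≡⟨ cong (λ n → ∑ n G) sL≡ ⟨
    ∑ (suc L) G
      ≡⟨ ∑G≡N ⟩
    N ∎
    where open ≡-Reasoning

  ∑l≤N : ∀ {K} → K + K ≤ suc L → ∑ K l ≤ N
  ∑l≤N {K} 2K≤ with K₀ , j , j≤1 , sL≡ ← halve (suc L) = begin
    ∑ K l                       ≤⟨ ∑-≤-length l K≤K₀ ⟩
    ∑ K₀ l                      ≤⟨ ∑-mono-≤ K₀ (l≤P 2K₀≤) ⟩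
    ∑ K₀ P                      ≤⟨ m≤m+n _ _ ⟩
    ∑ K₀ P + ∑ j (G ∘ (K₀ +_))  ≡⟨ fold-P K₀ j sL≡ ⟩
    N                           ∎
    where
    open ≤-Reasoning
    2K₀≤ : K₀ + K₀ ≤ suc L
    2K₀≤ = subst (K₀ + K₀ ≤_) (sym sL≡) (+-monoˡ-≤ K₀ (m≤m+n K₀ j))
    K≤K₀ : K ≤ K₀
    K≤K₀ = ≮⇒≥ λ K₀<K → <-irrefl refl (begin-strict
      suc (K₀ + K₀)     <⟨ s≤s (≤-reflexive (sym (+-suc K₀ K₀))) ⟩
      suc K₀ + suc K₀   ≤⟨ +-mono-≤ K₀<K K₀<K ⟩
      K + K             ≤⟨ 2K≤ ⟩
      suc L             ≡⟨ sL≡ ⟩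
      K₀ + j + K₀       ≤⟨ +-monoˡ-≤ K₀ (+-monoʳ-≤ K₀ j≤1) ⟩
      K₀ + 1 + K₀       ≡⟨ odd K₀ ⟩
      suc (K₀ + K₀)     ∎)
      where
      odd : ∀ k → k + 1 + k ≡ suc (k + k)
      odd = solve-∀

  2∣P+a : ∀ {a} → 2 ∣ L → 1 ≤ a → a + a < L → P a ≢ L → 2 ∣ P a + a
  2∣P+a {a} 2∣L 1≤a 2a<L Pa≢L with pair 1≤a 2a<L
  ... | lower a∈ b∉ = subst (λ p → 2 ∣ p + a) (sym (P-lower a∈ b∉)) (2∣n+n a)
  ... | upper a∉ b∈ = subst (λ p → 2 ∣ p + a) (sym (P-upper a∉ b∈))
                            (subst (2 ∣_) (sym (m∸n+n≡m (<⇒≤ (half<L 1≤a 2a<L)))) 2∣L)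
  ... | both  a∈ b∈ = contradiction (P-both (≤L a∈) a∈ b∈) Pa≢L

target : ℕ → ℕ
target m = triangular (9 + m) + (23 + m + m)

T≡target : ∀ m → T (11 + m) (7 + m) ≡ target m
T≡target m = begin
  (11 + m) * (12 + m) / 2 ∸ (7 + m)
    ≡⟨ cong (λ p → p / 2 ∸ (7 + m)) (triangular-double (11 + m)) ⟨
  triangular (12 + m) * 2 / 2 ∸ (7 + m)
    ≡⟨ cong (_∸ (7 + m)) (m*n/n≡m (triangular (12 + m)) 2) ⟩
  triangular (12 + m) ∸ (7 + m)
    ≡⟨ cong (_∸ (7 + m)) (∑-snoc³ (9 + m) id) ⟩
  triangular (9 + m) + (9 + m) + (10 + m) + (11 + m) ∸ (7 + m)
    ≡⟨ cong (_∸ (7 + m)) (regroup (triangular (9 + m)) m) ⟩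
  (7 + m) + target m ∸ (7 + m)
    ≡⟨ m+n∸m≡n (7 + m) (target m) ⟩
  target m
    ∎
  where
  open ≡-Reasoning
  regroup : ∀ t m → t + (9 + m) + (10 + m) + (11 + m) ≡ (7 + m) + (t + (23 + m + m))
  regroup = solve-∀

top : ℕ → List ℕ
top m = 7 + m ∷ 9 + m ∷ 11 + m ∷ 17 + m + m ∷ []

-- For n = 11 + m this is {1, …, n − 6, n − 4, n − 2, n, 2n − 5}.
extremal : ℕ → List ℕ
extremal m = applyUpTo suc (5 + m) ++ top m

extremal-increasing : ∀ m → Linked _<_ (extremal m)
extremal-increasing m = Linked.++⁺ {xs = applyUpTo suc (5 + m)}
  (Linked.applyUpTo⁺₂ suc (5 + m) (λ _ → ≤-refl))
  (subst (λ x → Connected _<_ x (just (7 + m))) (sym (last-applyUpTo suc (4 + m)))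
         (just (m<n⇒m<1+n (n<1+n (5 + m)))))
  (m<n⇒m<1+n (n<1+n (7 + m)) ∷ m<n⇒m<1+n (n<1+n (9 + m)) ∷ +-monoʳ-≤ 12 (m≤n+m m (5 + m)) ∷ [-])

extremal-positive : ∀ m → All (1 ≤_) (extremal m)
extremal-positive m = All.++⁺ (All.applyUpTo⁺₂ suc (5 + m) (λ _ → s≤s z≤n))
                              (s≤s z≤n ∷ s≤s z≤n ∷ s≤s z≤n ∷ s≤s z≤n ∷ [])

extremal-sum : ∀ m → sum (extremal m) ≡ target m
extremal-sum m = begin
  sum (applyUpTo suc (5 + m) ++ top m)  ≡⟨ sum-++ (applyUpTo suc (5 + m)) (top m) ⟩
  triangular (6 + m) + sum (top m)      ≡⟨ regroup (triangular (6 + m)) m ⟩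
  triangular (6 + m) + (6 + m) + (7 + m) + (8 + m) + (23 + m + m)
                                        ≡⟨ cong (_+ (23 + m + m)) (∑-snoc³ (6 + m) id) ⟨
  target m                              ∎
  where
  open ≡-Reasoning
  regroup : ∀ t m → t + (7 + m + (9 + m + (11 + m + (17 + m + m + 0))))
                  ≡ t + (6 + m) + (7 + m) + (8 + m) + (23 + m + m)
  regroup = solve-∀

extremal-largest : ∀ m → largest (extremal m) ≡ 17 + m + m
extremal-largest m = ≤-antisym
  (largest≤ (extremal m) (All.++⁺ (All.applyUpTo⁺₁ suc (5 + m) (λ i<5+m → ≤-trans i<5+m 5+m≤))
    (+-monoʳ-≤ 7 (m≤n+m m (10 + m)) ∷ +-monoʳ-≤ 9 (m≤n+m m (8 + m))
    ∷ +-monoʳ-≤ 11 (m≤n+m m (6 + m)) ∷ ≤-refl ∷ [])))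
  (∈⇒≤largest (extremal m) (∈-++⁺ʳ (applyUpTo suc (5 + m)) (there (there (there (here refl))))))
  where
  5+m≤ : 5 + m ≤ 17 + m + m
  5+m≤ = +-monoʳ-≤ 5 (m≤n+m m (12 + m))

∈-extremal⁻ : ∀ {m x} → x ∈ extremal m → (∃ λ i → i < 5 + m × x ≡ suc i) ⊎ x ∈ top m
∈-extremal⁻ {m} x∈ with ∈-++⁻ (applyUpTo suc (5 + m)) x∈
... | inj₁ x∈initial = inj₁ (∈-applyUpTo⁻ suc x∈initial)
... | inj₂ x∈top     = inj₂ x∈top

∈-extremal-initial : ∀ {m x} → 1 ≤ x → x ≤ 5 + m → x ∈ extremal m
∈-extremal-initial {m} {suc i} _ i<5+m = ∈-++⁺ˡ (∈-applyUpTo⁺ suc i<5+m)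

∈-extremal-top : ∀ {m x} → x ∈ top m → x ∈ extremal m
∈-extremal-top {m} = ∈-++⁺ʳ (applyUpTo suc (5 + m))

missing-extremal-≥ : ∀ {m a} → Missing (extremal m) a → ∃ λ d → a ≡ d + (6 + m)
missing-extremal-≥ (1≤a , _ , a∉) = ≤-offset (≮⇒≥ λ { (s≤s a≤5+m) → a∉ (∈-extremal-initial 1≤a a≤5+m) })

extremal-not-refinable : ∀ m → ¬ Refinable (extremal m)
extremal-not-refinable m (a , b , _ , a-missing , b-missing , a+b∈)
  with d , refl ← missing-extremal-≥ a-missing | e , refl ← missing-extremal-≥ b-missing
  = a+b-not-part (∈-extremal⁻ a+b∈)
  where
  a+b≡ : d + (6 + m) + (e + (6 + m)) ≡ (d + e) + (12 + m + m)
  a+b≡ = regroup d e m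
    where
    regroup : ∀ d e m → d + (6 + m) + (e + (6 + m)) ≡ (d + e) + (12 + m + m)
    regroup = solve-∀
  <a+b : ∀ {x} → x ≤ 11 + m → x < d + (6 + m) + (e + (6 + m))
  <a+b x≤ = ≤-trans (s≤s x≤)
    (subst (12 + m ≤_) (sym a+b≡) (≤-trans (+-monoʳ-≤ 12 (m≤m+n m m)) (m≤n+m _ (d + e))))
  split-5 : ∀ d e → d + e ≡ 5 → d + (6 + m) ∉ extremal m → e + (6 + m) ∉ extremal m → ⊥
  split-5 0 _ refl _ e∉ = e∉ (∈-extremal-top (there (there (here refl))))
  split-5 1 _ refl d∉ _ = d∉ (∈-extremal-top (here refl))
  split-5 2 _ refl _ e∉ = e∉ (∈-extremal-top (there (here refl)))
  split-5 3 _ refl d∉ _ = d∉ (∈-extremal-top (there (here refl)))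
  split-5 4 _ refl _ e∉ = e∉ (∈-extremal-top (here refl))
  split-5 5 _ refl d∉ _ = d∉ (∈-extremal-top (there (there (here refl))))
  a+b-not-part : (∃ λ i → i < 5 + m × _ ≡ suc i) ⊎ d + (6 + m) + (e + (6 + m)) ∈ top m → ⊥
  a+b-not-part (inj₁ (i , i<5+m , eq)) =
    <-irrefl (sym eq) (<a+b (≤-trans i<5+m (+-monoˡ-≤ m (m≤m+n 5 6))))
  a+b-not-part (inj₂ (here eq)) = <-irrefl (sym eq) (<a+b (+-monoˡ-≤ m (m≤m+n 7 4)))
  a+b-not-part (inj₂ (there (here eq))) = <-irrefl (sym eq) (<a+b (+-monoˡ-≤ m (m≤m+n 9 2)))
  a+b-not-part (inj₂ (there (there (here eq)))) = <-irrefl (sym eq) (<a+b ≤-refl)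
  a+b-not-part (inj₂ (there (there (there (here eq))))) =
    split-5 d e (+-cancelʳ-≡ (12 + m + m) (d + e) 5 (trans (sym a+b≡) eq))
            (proj₂ (proj₂ a-missing)) (proj₂ (proj₂ b-missing))

extremal-unrefinable : ∀ m → Unrefinable (target m) (extremal m)
extremal-unrefinable m = record
  { increasing = extremal-increasing m
  ; positive   = extremal-positive m
  ; sums       = extremal-sum m
  ; atLeastTwo = s≤s (s≤s z≤n)
  } , extremal-not-refinable m

module TargetPartition (m : ℕ) {μ : List ℕ} (μ-unrefinable : Unrefinable (target m) μ) where

  open Pairs μ-unrefinable

  pair-sum : ∀ c d → (c + m) + (d + m) ≡ c + d + m + m
  pair-sum c d = lemma c d m
    where
    lemma : ∀ c d m → (c + m) + (d + m) ≡ c + d + m + m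
    lemma = solve-∀

  L≱19+2m : ¬ (19 + m + m ≤ L)
  L≱19+2m 19+2m≤L = m+1+n≰m (target m) (begin
    target m + suc (4 + m)                       ≡⟨ regroup (triangular (9 + m)) m ⟩
    19 + m + m + (triangular (9 + m) + (9 + m))  ≤⟨ +-monoˡ-≤ _ 19+2m≤L ⟩
    L + (triangular (9 + m) + (9 + m))           ≡⟨ cong (L +_) (∑-snoc (9 + m) id) ⟨
    ∑ (10 + m) l                                 ≤⟨ ∑l≤N (≤-trans (≤-reflexive (pair-sum 10 10)) (s≤s 19+2m≤L)) ⟩
    target m                                     ∎)
    where
    open ≤-Reasoning
    regroup : ∀ t m → t + (23 + m + m) + suc (4 + m) ≡ 19 + m + m + (t + (9 + m))
    regroup = solve-∀

  L≢18+2m : L ≢ 18 + m + m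
  L≢18+2m L≡ =
    from-no (2 ∣? 5) (∣m+n∣m⇒∣n (subst (2 ∣_) ∑P+l≡ (∣-∑ (9 + m) 2∣P+l)) (2∣n+n (∑ (9 + m) l)))
    where
    2K≤ : (9 + m) + (9 + m) ≤ suc L
    2K≤ = ≤-trans (≤-reflexive (trans (pair-sum 9 9) (sym L≡))) (n≤1+n L)
    budget : ∑ (9 + m) P + (G (9 + m + 0) + 0) ≡ ∑ (9 + m) l + 5
    budget = begin
      ∑ (9 + m) P + (G (9 + m + 0) + 0)  ≡⟨ fold-P (9 + m) 1 (trans (cong suc L≡) (regroup m)) ⟩
      target m                           ≡⟨ regroup₂ (triangular (9 + m)) m ⟩
      18 + m + m + triangular (9 + m) + 5 ≡⟨ cong (λ x → x + triangular (9 + m) + 5) L≡ ⟨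
      ∑ (9 + m) l + 5                    ∎
      where
      open ≡-Reasoning
      regroup : ∀ m → 19 + m + m ≡ 9 + m + 1 + (9 + m)
      regroup = solve-∀
      regroup₂ : ∀ t m → t + (23 + m + m) ≡ 18 + m + m + t + 5
      regroup₂ = solve-∀
    middle≡0 : G (9 + m + 0) ≡ 0
    middle≡0 = G<⇒≡0 (begin-strict
      G (9 + m + 0)      ≤⟨ m≤m+n _ 0 ⟩
      G (9 + m + 0) + 0  ≤⟨ +-cancelˡ-≤ (∑ (9 + m) l) _ _ (begin
        ∑ (9 + m) l + (G (9 + m + 0) + 0)  ≤⟨ +-monoˡ-≤ _ (∑-mono-≤ (9 + m) (l≤P 2K≤)) ⟩
        ∑ (9 + m) P + (G (9 + m + 0) + 0)  ≡⟨ budget ⟩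
        ∑ (9 + m) l + 5                    ∎) ⟩
      5                  <⟨ m≤m+n 6 (3 + m + 0) ⟩
      9 + m + 0          ∎)
      where open ≤-Reasoning
    ∑P≡ : ∑ (9 + m) P ≡ ∑ (9 + m) l + 5
    ∑P≡ = trans (sym (trans (cong (λ g → ∑ (9 + m) P + (g + 0)) middle≡0) (+-identityʳ _))) budget
    slack : ∀ {a} → a < 9 + m → P a ≤ l a + 5
    slack = ∑-slack (9 + m) (l≤P 2K≤) ∑P≡
    2∣P+l : ∀ {a} → a < 9 + m → 2 ∣ P a + l a
    2∣P+l {zero}  _   = subst (λ p → 2 ∣ p + L) (sym P0≡L) (2∣n+n L)
    2∣P+l {suc a} a<K = 2∣P+a (subst (2 ∣_) (trans (pair-sum 9 9) (sym L≡)) (2∣n+n (9 + m)))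
      z<s (pairable 2K≤ a<K) λ Pa≡L → <-irrefl Pa≡L (begin-strict
        P (suc a)   ≤⟨ slack a<K ⟩
        suc a + 5   <⟨ +-monoˡ-≤ 5 a<K ⟩
        9 + m + 5   ≡⟨ +-comm (9 + m) 5 ⟩
        14 + m      ≤⟨ +-monoʳ-≤ 14 (m≤n+m m (4 + m)) ⟩
        18 + m + m  ≡⟨ L≡ ⟨
        L           ∎)
      where open ≤-Reasoning
    ∑P+l≡ : ∑ (9 + m) (λ a → P a + l a) ≡ ∑ (9 + m) l + ∑ (9 + m) l + 5
    ∑P+l≡ = trans (∑-+ (9 + m) P l) (trans (cong (_+ ∑ (9 + m) l) ∑P≡) (regroup (∑ (9 + m) l)))
      where
      regroup : ∀ x → x + 5 + x ≡ x + x + 5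
      regroup = solve-∀

  L≤17+2m : L ≤ 17 + m + m
  L≤17+2m with <-cmp L (18 + m + m)
  ... | tri< L<18+2m _ _ = ≤-pred L<18+2m
  ... | tri≈ _ L≡ _      = contradiction L≡ L≢18+2m
  ... | tri> _ _ 18+2m<L = contradiction 18+2m<L L≱19+2m

  module Top (L≡ : L ≡ 17 + m + m) where

    2K≤ : (9 + m) + (9 + m) ≤ suc L
    2K≤ = ≤-reflexive (trans (pair-sum 9 9) (cong suc (sym L≡)))

    ∑P≡ : ∑ (9 + m) P ≡ ∑ (9 + m) l + 6
    ∑P≡ = begin
      ∑ (9 + m) P                          ≡⟨ +-identityʳ _ ⟨
      ∑ (9 + m) P + 0                      ≡⟨ fold-P (9 + m) 0 (trans (cong suc L≡) (regroup₀ m)) ⟩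
      target m                             ≡⟨ regroup (triangular (9 + m)) m ⟩
      17 + m + m + triangular (9 + m) + 6  ≡⟨ cong (λ x → x + triangular (9 + m) + 6) L≡ ⟨
      ∑ (9 + m) l + 6                      ∎
      where
      open ≡-Reasoning
      regroup₀ : ∀ m → 18 + m + m ≡ 9 + m + 0 + (9 + m)
      regroup₀ = solve-∀
      regroup : ∀ t m → t + (23 + m + m) ≡ 17 + m + m + t + 6
      regroup = solve-∀

    slack : ∀ {a} → a < 9 + m → P a ≤ l a + 6
    slack = ∑-slack (9 + m) (l≤P 2K≤) ∑P≡

    partner : ∀ {a b} → a + b ≡ 17 + m + m → L ∸ a ≡ b
    partner {a} {b} a+b≡ = trans (cong (_∸ a) (trans L≡ (sym a+b≡))) (m+n∸m≡n a b)

    below-L : ∀ {x} → x ≤ 16 + m + m → x < L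
    below-L x≤ = subst (_ <_) (sym L≡) (s≤s x≤)

    initial : ∀ {a} → 1 ≤ a → a ≤ 5 + m → a ∈ μ × L ∸ a ∉ μ
    initial {suc i} _ a≤5+m = lower-only (pair z<s (pairable 2K≤ a<9+m))
      where
      a<9+m : suc i < 9 + m
      a<9+m = ≤-trans (s≤s a≤5+m) (+-monoˡ-≤ m (m≤m+n 6 3))
      a+6+a≤ : suc i + 6 + suc i ≤ 16 + m + m
      a+6+a≤ = ≤-trans (+-mono-≤ (+-monoˡ-≤ 6 a≤5+m) a≤5+m) (≤-reflexive (regroup m))
        where
        regroup : ∀ m → 5 + m + 6 + (5 + m) ≡ 16 + m + m
        regroup = solve-∀
      lower-only : Pair (suc i) → suc i ∈ μ × L ∸ suc i ∉ μ
      lower-only (lower a∈ b∉) = a∈ , b∉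
      lower-only (upper a∉ b∈) = contradiction (slack a<9+m) (<⇒≱ (subst (suc i + 6 <_)
        (sym (P-upper a∉ b∈)) (m+n≤o⇒m≤o∸n (suc (suc i + 6)) (below-L a+6+a≤))))
      lower-only (both a∈ b∈) = contradiction (slack a<9+m) (<⇒≱ (subst (suc i + 6 <_)
        (sym (P-both (≤L a∈) a∈ b∈)) (below-L (≤-trans (m≤m+n _ (suc i)) a+6+a≤))))

    Split : ℕ → ℕ → Set
    Split a b = (a ∈ μ × b ∉ μ × P a ≡ a) ⊎ (a ∉ μ × b ∈ μ × P a ≡ b)

    middle : ∀ {a b} → 1 ≤ a → a < 9 + m → a + b ≡ 17 + m + m → Split a b
    middle {suc i} {b} _ a<9+m a+b≡ = lower-or-upper (pair z<s (pairable 2K≤ a<9+m))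
      where
      a+6≤ : suc i + 6 ≤ 16 + m + m
      a+6≤ = ≤-trans (+-monoˡ-≤ 6 (≤-pred a<9+m)) (≤-trans (≤-reflexive (+-comm (8 + m) 6))
               (+-monoʳ-≤ 14 (m≤n+m m (2 + m))))
      lower-or-upper : Pair (suc i) → Split (suc i) b
      lower-or-upper (lower a∈ b∉) = inj₁ (a∈ , subst (_∉ μ) (partner a+b≡) b∉ , P-lower a∈ b∉)
      lower-or-upper (upper a∉ b∈) =
        inj₂ (a∉ , subst (_∈ μ) (partner a+b≡) b∈ , trans (P-upper a∉ b∈) (partner a+b≡))
      lower-or-upper (both  a∈ b∈) = contradiction (slack a<9+m) (<⇒≱ (subst (suc i + 6 <_)
        (sym (P-both (≤L a∈) a∈ b∈)) (below-L a+6≤)))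

    ∑P≡∑l-initial : ∑ (6 + m) P ≡ ∑ (6 + m) l
    ∑P≡∑l-initial = ∑-cong (6 + m) {P} {l} P≡l
      where
      P≡l : ∀ {a} → a < 6 + m → P a ≡ l a
      P≡l {zero}  _            = P0≡L
      P≡l {suc a} (s≤s a≤5+m) = P-lower (proj₁ (initial z<s a≤5+m)) (proj₂ (initial z<s a≤5+m))

    middle-sum : P (6 + m) + P (7 + m) + P (8 + m) ≡ (6 + m) + (7 + m) + (8 + m) + 6
    middle-sum = +-cancelˡ-≡ (∑ (6 + m) l) _ _ (begin
      ∑ (6 + m) l + (P (6 + m) + P (7 + m) + P (8 + m))
        ≡⟨ cong (_+ (P (6 + m) + P (7 + m) + P (8 + m))) ∑P≡∑l-initial ⟨
      ∑ (6 + m) P + (P (6 + m) + P (7 + m) + P (8 + m))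
        ≡⟨ regroup₁ (∑ (6 + m) P) (P (6 + m)) (P (7 + m)) (P (8 + m)) ⟨
      ∑ (6 + m) P + P (6 + m) + P (7 + m) + P (8 + m)
        ≡⟨ ∑-snoc³ (6 + m) P ⟨
      ∑ (9 + m) P
        ≡⟨ ∑P≡ ⟩
      ∑ (9 + m) l + 6
        ≡⟨ cong (_+ 6) (∑-snoc³ (6 + m) l) ⟩
      ∑ (6 + m) l + (6 + m) + (7 + m) + (8 + m) + 6
        ≡⟨ regroup₂ (∑ (6 + m) l) (6 + m) (7 + m) (8 + m) 6 ⟩
      ∑ (6 + m) l + ((6 + m) + (7 + m) + (8 + m) + 6)
        ∎)
      where
      open ≡-Reasoning
      regroup₁ : ∀ s x y z → s + x + y + z ≡ s + (x + y + z)
      regroup₁ = solve-∀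
      regroup₂ : ∀ s x y z c → s + x + y + z + c ≡ s + (x + y + z + c)
      regroup₂ = solve-∀

    middle-total : ∀ c₁ c₂ c₃ → P (6 + m) ≡ c₁ + m → P (7 + m) ≡ c₂ + m → P (8 + m) ≡ c₃ + m
                 → c₁ + c₂ + c₃ ≡ 27
    middle-total c₁ c₂ c₃ p q r = +-cancelʳ-≡ (m + m + m) _ _ (begin
      c₁ + c₂ + c₃ + (m + m + m)           ≡⟨ regroup c₁ c₂ c₃ m ⟩
      (c₁ + m) + (c₂ + m) + (c₃ + m)       ≡⟨ cong₂ _+_ (cong₂ _+_ p q) r ⟨
      P (6 + m) + P (7 + m) + P (8 + m)    ≡⟨ middle-sum ⟩
      (6 + m) + (7 + m) + (8 + m) + 6      ≡⟨ regroup₂ m ⟩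
      27 + (m + m + m)                     ∎)
      where
      open ≡-Reasoning
      regroup : ∀ c₁ c₂ c₃ m → c₁ + c₂ + c₃ + (m + m + m) ≡ (c₁ + m) + (c₂ + m) + (c₃ + m)
      regroup = solve-∀
      regroup₂ : ∀ m → (6 + m) + (7 + m) + (8 + m) + 6 ≡ 27 + (m + m + m)
      regroup₂ = solve-∀

    Middle : Set
    Middle = (6 + m ∉ μ × 11 + m ∈ μ) × (7 + m ∈ μ × 10 + m ∉ μ) × (8 + m ∉ μ × 9 + m ∈ μ)

    middle-members : Middle
    middle-members = choose (middle z<s (+-monoˡ-≤ m (m≤m+n 7 2)) (pair-sum 6 11))
                            (middle z<s (+-monoˡ-≤ m (m≤m+n 8 1)) (pair-sum 7 10))
                            (middle z<s ≤-refl (pair-sum 8 9))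
      where
      -- Among 6 or 11, 7 or 10, 8 or 9 only 11 + 7 + 9 adds up to 6 + 7 + 8 + 6 = 27.
      choose : Split (6 + m) (11 + m) → Split (7 + m) (10 + m) → Split (8 + m) (9 + m) → Middle
      choose (inj₂ (6∉ , 11∈ , _)) (inj₁ (7∈ , 10∉ , _)) (inj₂ (8∉ , 9∈ , _)) = (6∉ , 11∈) , (7∈ , 10∉) , (8∉ , 9∈)
      choose (inj₁ (_ , _ , p)) (inj₁ (_ , _ , q)) (inj₁ (_ , _ , r)) = contradiction (middle-total 6 7 8 p q r) λ ()
      choose (inj₁ (_ , _ , p)) (inj₁ (_ , _ , q)) (inj₂ (_ , _ , r)) = contradiction (middle-total 6 7 9 p q r) λ ()
      choose (inj₁ (_ , _ , p)) (inj₂ (_ , _ , q)) (inj₁ (_ , _ , r)) = contradiction (middle-total 6 10 8 p q r) λ ()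
      choose (inj₁ (_ , _ , p)) (inj₂ (_ , _ , q)) (inj₂ (_ , _ , r)) = contradiction (middle-total 6 10 9 p q r) λ ()
      choose (inj₂ (_ , _ , p)) (inj₁ (_ , _ , q)) (inj₁ (_ , _ , r)) = contradiction (middle-total 11 7 8 p q r) λ ()
      choose (inj₂ (_ , _ , p)) (inj₂ (_ , _ , q)) (inj₁ (_ , _ , r)) = contradiction (middle-total 11 10 8 p q r) λ ()
      choose (inj₂ (_ , _ , p)) (inj₂ (_ , _ , q)) (inj₂ (_ , _ , r)) = contradiction (middle-total 11 10 9 p q r) λ ()

    upper-absent : ∀ {x} → 12 + m ≤ x → x < L → x ∉ μ
    upper-absent {x} 12+m≤x x<L = subst (_∉ μ) (m∸[m∸n]≡n (<⇒≤ x<L))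
      (proj₂ (initial (m<n⇒0<n∸m x<L)
        (≤-trans (∸-monoʳ-≤ L 12+m≤x) (≤-reflexive (partner {12 + m} (pair-sum 12 5))))))

    above-middle : Middle → ∀ d → d + (6 + m) ∈ μ → d + (6 + m) ∈ extremal m
    above-middle ((6∉ , _) , _)         0 x∈ = contradiction x∈ 6∉
    above-middle _                      1 _  = ∈-extremal-top (here refl)
    above-middle (_ , _ , (8∉ , _))     2 x∈ = contradiction x∈ 8∉
    above-middle _                      3 _  = ∈-extremal-top (there (here refl))
    above-middle (_ , (_ , 10∉) , _)    4 x∈ = contradiction x∈ 10∉
    above-middle _                      5 _  = ∈-extremal-top (there (there (here refl)))
    above-middle _ (2+ (2+ (2+ e))) x∈ with m≤n⇒m<n∨m≡n (≤L x∈)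
    ... | inj₁ x<L = contradiction x∈ (upper-absent (+-monoʳ-≤ 6 (m≤n+m (6 + m) e)) x<L)
    ... | inj₂ x≡L = ∈-extremal-top (there (there (there (here (trans x≡L L≡)))))

    μ⊆extremal : ∀ {x} → x ∈ μ → x ∈ extremal m
    μ⊆extremal {x} x∈ with x ≤? 5 + m
    ... | yes x≤5+m = ∈-extremal-initial (All.lookup positive x∈) x≤5+m
    ... | no  x≰5+m with d , refl ← ≤-offset (≰⇒> x≰5+m) = above-middle middle-members d x∈

    top⊆μ : Middle → ∀ {x} → x ∈ top m → x ∈ μ
    top⊆μ (_ , (7∈ , _) , _) (here refl)                         = 7∈
    top⊆μ (_ , _ , (_ , 9∈)) (there (here refl))                 = 9∈
    top⊆μ ((_ , 11∈) , _)    (there (there (here refl)))         = 11∈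
    top⊆μ _                  (there (there (there (here refl)))) = subst (_∈ μ) L≡ L∈μ

    extremal⊆μ : ∀ {x} → x ∈ extremal m → x ∈ μ
    extremal⊆μ x∈ with ∈-extremal⁻ x∈
    ... | inj₁ (i , i<5+m , refl) = proj₁ (initial z<s i<5+m)
    ... | inj₂ x∈top              = top⊆μ middle-members x∈top

    μ≡extremal : μ ≡ extremal m
    μ≡extremal = increasing-≡ increasing (extremal-increasing m) (mk⇔ μ⊆extremal extremal⊆μ)

largest≤extremal : ∀ m {μ} → Unrefinable (target m) μ → largest μ ≤ largest (extremal m)
largest≤extremal m {μ} μ-unrefinable =
  subst (largest μ ≤_) (sym (extremal-largest m)) (TargetPartition.L≤17+2m m μ-unrefinable)

extremal-unique : ∀ m {μ} → InUStar (target m) μ → μ ≡ extremal m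
extremal-unique m {μ} (μ-unrefinable , μ-maximal) = TargetPartition.Top.μ≡extremal m μ-unrefinable
  (≤-antisym (TargetPartition.L≤17+2m m μ-unrefinable)
             (subst (_≤ largest μ) (extremal-largest m) (μ-maximal (extremal m) (extremal-unrefinable m))))

corollary3p13 : (n : ℕ) → 11 ≤ n →
    ∃[ λs ] (InUStar (T n (n ∸ 4)) λs × (∀ μ → InUStar (T n (n ∸ 4)) μ → μ ≡ λs))
corollary3p13 n 11≤n with m , refl ← m≤n⇒∃[o]m+o≡n 11≤n =
  subst (λ N → ∃[ λs ] (InUStar N λs × (∀ μ → InUStar N μ → μ ≡ λs))) (sym (T≡target m))
    (extremal m , (extremal-unrefinable m , λ _ → largest≤extremal m) , λ _ → extremal-unique m)
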